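{- Let $G$ be a graph with pathwidth at most $p$. Then $\operatorname{pqn}(G)\le p+1$.
   Context: All graphs are finite, simple and undirected; pathwidth is the usual graph parameter (minimum width of a path decomposition). An edge-weighted graph $\langle G,w\rangle$ is a graph $G=(V,E)$ with $w\colon E\to\mathbb{R}$. A PQ-layout of $\langle G,w\rangle$ with $k$ priority queues consists of a linear ordering $\prec$ of $V$ and a partition of $E$ into $k$ sets $\mathcal{P}_1,\dots,\mathcal{P}_k$ such that there is no $i$ and no two edges $e=uv$, $e'=u'v'$ in $\mathcal{P}_i$ with $w(e)>w(e')$ and $u\prec v$, $u'\prec v$, $v\prec v'$. $\operatorname{pqn}(G,w)$ is the minimum $k\ge0$ such that $\langle G,w\rangle$ has a PQ-layout with $k$ priority queues, and $\operatorname{pqn}(G)$ is the minimum $k\ge0$ such that $\operatorname{pqn}(G,w)\le k$ for every $w\colon E\to\mathbb{R}$. -}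

module Defs where

open import Data.Nat using (ℕ; suc; _≤_)
open import Data.Fin using (Fin) renaming (_<_ to _<ᶠ_)
open import Data.Fin.Subset using (Subset; _∈_; ∣_∣)
open import Data.Fin.Permutation using (Permutation′; _⟨$⟩ʳ_)
open import Data.Product using (_×_; _,_; proj₁; proj₂; Σ; ∃)
open import Data.Sum using (_⊎_)
open import Relation.Binary.PropositionalEquality using (_≡_; _≢_)
open import Relation.Binary.Bundles using (StrictTotalOrder)
open import Relation.Nullary using (¬_)
open import Level using (0ℓ)

-- A finite simple undirected graph: vertex set Fin n, edge set Fin m,
-- each edge given by its two (distinct) endpoints; distinct edges have
-- distinct unordered endpoint pairs (no multi-edges).
record Graph : Set where
  field
    n    : ℕ
    m    : ℕ
    ends : Fin m → Fin n × Fin n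
    loopless : ∀ e → proj₁ (ends e) ≢ proj₂ (ends e)
    simple   : ∀ e e′ → (ends e ≡ ends e′ ⊎ ends e ≡ (proj₂ (ends e′) , proj₁ (ends e′))) → e ≡ e′

open Graph public

EdgeIs : (G : Graph) → Fin (m G) → Fin (n G) → Fin (n G) → Set
EdgeIs G e u v = ends G e ≡ (u , v) ⊎ ends G e ≡ (v , u)

record PathDecomposition (G : Graph) (p : ℕ) : Set where
  field
    r        : ℕ
    bag      : Fin r → Subset (n G)
    bagSize  : ∀ i → ∣ bag i ∣ ≤ suc p
    vCover   : ∀ v → ∃ λ i → v ∈ bag i
    eCover   : ∀ e → ∃ λ i → proj₁ (ends G e) ∈ bag i × proj₂ (ends G e) ∈ bag i
    contig   : ∀ i j k v → i <ᶠ j → j <ᶠ k → v ∈ bag i → v ∈ bag k → v ∈ bag j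

PathwidthAtMost : Graph → ℕ → Set
PathwidthAtMost G p = PathDecomposition G p

-- The partition of E into P_1..P_k is given by queue : E → Fin k.
module _ (O : StrictTotalOrder 0ℓ 0ℓ 0ℓ) where
  open StrictTotalOrder O renaming (Carrier to W; _<_ to _<ʷ_)

  record PQLayout (G : Graph) (w : Fin (m G) → W) (k : ℕ) : Set where
    field
      pos   : Permutation′ (n G)
      queue : Fin (m G) → Fin k
    _≺_ : Fin (n G) → Fin (n G) → Set
    u ≺ v = (pos ⟨$⟩ʳ u) <ᶠ (pos ⟨$⟩ʳ v)
    field
      valid : ∀ e e′ u v u′ v′ → EdgeIs G e u v → EdgeIs G e′ u′ v′ →
              queue e ≡ queue e′ →
              ¬ (w e′ <ʷ w e × u ≺ v × u′ ≺ v × v ≺ v′)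

PqnAtMost : Graph → ℕ → Set₁
PqnAtMost G k = (O : StrictTotalOrder 0ℓ 0ℓ 0ℓ) →
  (w : Fin (m G) → StrictTotalOrder.Carrier O) → PQLayout O G w k

{-# OPTIONS --safe #-}
module Submission where

-- Order the vertices by the last bag containing them. If u′v′ is an edge and u′ ≺ v ≺ v′, then
-- v′ lies in the last bag of v, because that bag sits between a bag containing u′v′ (no later
-- than the last bag of u′) and the last bag of v′. Colour the vertices greedily from right to
-- left, giving v a colour unused by its successors in the last bag of v; that bag has at most
-- p + 1 vertices including v, so p + 1 colours suffice. Put every edge into the queue named by
-- the colour of its right endpoint: two edges uv, u′v′ of one queue then never satisfy
-- u ≺ v, u′ ≺ v ≺ v′, whatever the weights.

open import Defs
open import Data.Bool using (true)
open import Data.Fin using (Fin; zero; suc; toℕ; fromℕ<; combine; punchOut)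
  renaming (_<_ to _<ᶠ_; _≤_ to _≤ᶠ_)
open import Data.Fin.Properties
  using (_≟_; any?; ¬∀⟶∃¬; 0≢1+n; suc-injective; toℕ-injective; toℕ-fromℕ<;
         punchOut-injective; injective⇒≤; combine-monoˡ-<; combine-injectiveʳ; ≤∧≢⇒<)
  renaming (_<?_ to _<ᶠ?_; <-irrefl to <ᶠ-irrefl; <-asym to <ᶠ-asym; <-trans to <ᶠ-trans)
open import Data.Fin.Permutation using (Permutation′; permutation; _⟨$⟩ʳ_; _⟨$⟩ˡ_; inverseˡ; inverseʳ)
open import Data.Fin.Subset using (Subset; _∈_; ∣_∣; ⊤; _-_)
open import Data.Fin.Subset.Properties
  using (_∈?_; ∈⊤; ∣⊤∣≡n; p⊂q⇒∣p∣<∣q∣; x∈p∧x≢y⇒x∈p-y; x∈p⇒∣p-x∣<∣p∣)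
open import Data.Nat using (ℕ; zero; suc; _≤_; _<_; _<?_; z≤n; s≤s; z<s; s<s; s<s⁻¹)
open import Data.Nat.Properties
  using (<-irrefl; <-asym; <-trans; ≤-trans; ≤-<-trans; <-≤-trans; ≤-antisym; ≤-reflexive;
         <⇒≤; <⇒≱; ≮⇒≥; 1+n≰n)
  renaming (≤∧≢⇒< to ≤∧≢⇒<ℕ)
open import Data.Product using (∃; _×_; _,_; proj₁; proj₂)
import Data.Product as Product
open import Data.Sum using (inj₁; inj₂)
open import Data.Vec using (tabulate)
open import Data.Vec.Properties using (lookup∘tabulate; []=⇒lookup; lookup⇒[]=)
open import Function using (_∘_)
open import Function.Definitions using (Injective)
open import Relation.Binary.PropositionalEquality
  using (_≡_; _≢_; refl; sym; trans; cong; subst; subst₂; module ≡-Reasoning)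
open import Relation.Nullary using (¬_; Dec; yes; no; does; contradiction)
open import Relation.Nullary.Decidable using (_×-dec_; dec-true)
open import Relation.Unary using (Decidable)

injective⇒≤∣p∣ : ∀ {m n} {f : Fin m → Fin n} (p : Subset n) →
                 Injective _≡_ _≡_ f → (∀ i → f i ∈ p) → m ≤ ∣ p ∣
injective⇒≤∣p∣ {zero}          _ _     _   = z≤n
injective⇒≤∣p∣ {suc m} {f = f} p f-inj f∈p =
  ≤-<-trans (injective⇒≤∣p∣ (p - f zero) (suc-injective ∘ f-inj) f∘suc∈p-f0)
            (x∈p⇒∣p-x∣<∣p∣ (f∈p zero))
  where
  f∘suc∈p-f0 : ∀ i → f (suc i) ∈ p - f zero
  f∘suc∈p-f0 i = x∈p∧x≢y⇒x∈p-y (f∈p (suc i)) (0≢1+n ∘ sym ∘ f-inj)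

injective⇒surjective : ∀ {n} {f : Fin n → Fin n} → Injective _≡_ _≡_ f → ∀ y → ∃ λ x → f x ≡ y
injective⇒surjective {suc n} {f} f-inj y with any? (λ x → f x ≟ y)
... | yes hit = hit
... | no miss =
  contradiction (injective⇒≤ {f = f∖y} (f-inj ∘ punchOut-injective (y≢f _) (y≢f _))) 1+n≰n
  where
  y≢f : ∀ x → y ≢ f x
  y≢f x = miss ∘ (x ,_) ∘ sym
  f∖y : Fin (suc n) → Fin n
  f∖y x = punchOut (y≢f x)

injective⇒permutation : ∀ {n} (f : Fin n → Fin n) → Injective _≡_ _≡_ f → Permutation′ n
injective⇒permutation f f-inj =
  permutation f (proj₁ ∘ surj) (proj₂ ∘ surj) (λ x → f-inj (proj₂ (surj (f x))))
  where surj = injective⇒surjective f-inj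

⟨$⟩ˡ-injective : ∀ {n} (π : Permutation′ n) → Injective _≡_ _≡_ (π ⟨$⟩ˡ_)
⟨$⟩ˡ-injective π {i} {j} eq = begin
  i                     ≡⟨ inverseʳ π ⟨
  π ⟨$⟩ʳ (π ⟨$⟩ˡ i)     ≡⟨ cong (π ⟨$⟩ʳ_) eq ⟩
  π ⟨$⟩ʳ (π ⟨$⟩ˡ j)     ≡⟨ inverseʳ π ⟩
  j                     ∎
  where open ≡-Reasoning

subsetOf : ∀ {n} {P : Fin n → Set} → Decidable P → Subset n
subsetOf P? = tabulate (does ∘ P?)

∈-subsetOf⁺ : ∀ {n} {P : Fin n → Set} (P? : Decidable P) {x} → P x → x ∈ subsetOf P?
∈-subsetOf⁺ P? {x} Px = lookup⇒[]= x _ (trans (lookup∘tabulate (does ∘ P?) x) (dec-true (P? x) Px))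

∈-subsetOf⁻ : ∀ {n} {P : Fin n → Set} (P? : Decidable P) {x} → x ∈ subsetOf P? → P x
∈-subsetOf⁻ P? {x} x∈ = witness (P? x) (trans (sym (lookup∘tabulate (does ∘ P?) x)) ([]=⇒lookup x∈))
  where
  witness : ∀ {A : Set} (A? : Dec A) → does A? ≡ true → A
  witness (yes a) _ = a

lastSatisfying : ∀ {n} {P : Fin n → Set} → Decidable P → ∃ P →
                 ∃ λ i → P i × (∀ {j} → P j → j ≤ᶠ i)
lastSatisfying {suc n} P? (i , Pi) with any? (P? ∘ suc)
... | yes ∃Psuc with lastSatisfying (P? ∘ suc) ∃Psuc
...   | j , Pj , j-last = suc j , Pj , λ { {zero} _ → z≤n ; {suc k} Pk → s≤s (j-last Pk) }
lastSatisfying {suc n} P? (zero , P0) | no ∄Psuc =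
  zero , P0 , λ { {zero} _ → z≤n ; {suc k} Pk → contradiction (k , Pk) ∄Psuc }
lastSatisfying {suc n} P? (suc i , Pi) | no ∄Psuc = contradiction (i , Pi) ∄Psuc

module _ {n} (key : Fin n → ℕ) (key-injective : Injective _≡_ _≡_ key) where

  private
    below : Fin n → Subset n
    below x = subsetOf (λ y → key y <? key x)

    ∈-below⁺ : ∀ {x y} → key y < key x → y ∈ below x
    ∈-below⁺ {x} = ∈-subsetOf⁺ (λ y → key y <? key x)

    ∈-below⁻ : ∀ {x y} → y ∈ below x → key y < key x
    ∈-below⁻ {x} = ∈-subsetOf⁻ (λ y → key y <? key x)

    rank : Fin n → ℕ
    rank x = ∣ below x ∣

    rank-mono : ∀ {x y} → key x < key y → rank x < rank y
    rank-mono {x} kx<ky = p⊂q⇒∣p∣<∣q∣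
      ((λ z∈ → ∈-below⁺ (<-trans (∈-below⁻ z∈) kx<ky)) , x , ∈-below⁺ kx<ky , <-irrefl refl ∘ ∈-below⁻)

    rank<n : ∀ x → rank x < n
    rank<n x = subst (rank x <_) (∣⊤∣≡n n)
      (p⊂q⇒∣p∣<∣q∣ ((λ _ → ∈⊤) , x , ∈⊤ , <-irrefl refl ∘ ∈-below⁻))

    key-≤ : ∀ {x y} → rank x ≤ rank y → key x ≤ key y
    key-≤ rx≤ry = ≮⇒≥ (λ ky<kx → <⇒≱ (rank-mono ky<kx) rx≤ry)

    position : Fin n → Fin n
    position x = fromℕ< (rank<n x)

    toℕ-position : ∀ x → toℕ (position x) ≡ rank x
    toℕ-position x = toℕ-fromℕ< (rank<n x)

    position-injective : Injective _≡_ _≡_ position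
    position-injective {x} {y} eq =
      key-injective (≤-antisym (key-≤ (≤-reflexive rx≡ry)) (key-≤ (≤-reflexive (sym rx≡ry))))
      where
      rx≡ry : rank x ≡ rank y
      rx≡ry = trans (sym (toℕ-position x)) (trans (cong toℕ eq) (toℕ-position y))

  sortByInjective : Permutation′ n
  sortByInjective = injective⇒permutation position position-injective

  sortByInjective-sorted : ∀ {x y} →
                           sortByInjective ⟨$⟩ʳ x <ᶠ sortByInjective ⟨$⟩ʳ y → key x < key y
  sortByInjective-sorted {x} {y} πx<πy =
    ≤∧≢⇒<ℕ (key-≤ (<⇒≤ rx<ry)) (λ kx≡ky → <-irrefl (cong rank (key-injective kx≡ky)) rx<ry)
    where
    rx<ry : rank x < rank y
    rx<ry = subst₂ _<_ (toℕ-position x) (toℕ-position y) πx<πy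

module _ {m n} (key : Fin n → Fin m) where

  private
    -- combine enumerates Fin m × Fin n lexicographically: sorting by code sorts by key,
    -- breaking ties by index.
    code : Fin n → ℕ
    code x = toℕ (combine (key x) x)

    code-injective : Injective _≡_ _≡_ code
    code-injective {x} {y} = combine-injectiveʳ (key x) x (key y) y ∘ toℕ-injective

  sortBy : Permutation′ n
  sortBy = sortByInjective code code-injective

  sortBy-sorted : ∀ {x y} → sortBy ⟨$⟩ʳ x <ᶠ sortBy ⟨$⟩ʳ y → key x ≤ᶠ key y
  sortBy-sorted {x} {y} πx<πy =
    ≮⇒≥ (λ ky<kx → <-asym (sortByInjective-sorted code code-injective πx<πy) (combine-monoˡ-< y x ky<kx))

-- A record rather than a function type, so that P can be inferred from FewerThan c P.
record FewerThan {n} (c : ℕ) (P : Fin n → Set) : Set where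
  field
    noInjection : (f : Fin c → Fin n) → Injective _≡_ _≡_ f → ¬ (∀ k → P (f k))

open FewerThan

∣p∣<⇒fewerThan : ∀ {n c} (p : Subset n) → ∣ p ∣ < c → FewerThan c (_∈ p)
∣p∣<⇒fewerThan p ∣p∣<c .noInjection f f-inj f∈p = <⇒≱ ∣p∣<c (injective⇒≤∣p∣ p f-inj f∈p)

fewerThan-reindex : ∀ {m n c} {P : Fin m → Set} {Q : Fin n → Set} (g : Fin m → Fin n) →
                    Injective _≡_ _≡_ g → (∀ {i} → P i → Q (g i)) → FewerThan c Q → FewerThan c P
fewerThan-reindex g g-inj P⇒Q Q-few .noInjection f f-inj Pf =
  Q-few .noInjection (g ∘ f) (f-inj ∘ g-inj) (P⇒Q ∘ Pf)

freeColour : ∀ {n c} {P : Fin n → Set} → Decidable P → FewerThan c P →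
             (col : Fin n → Fin c) → ∃ λ a → ∀ {j} → P j → col j ≢ a
freeColour {c = c} {P} P? few col = Product.map₂ unused (¬∀⟶∃¬ c Used used? notAllUsed)
  where
  Used : Fin c → Set
  Used a = ∃ λ j → P j × col j ≡ a

  used? : Decidable Used
  used? a = any? (λ j → P? j ×-dec col j ≟ a)

  notAllUsed : ¬ (∀ a → Used a)
  notAllUsed witness = few .noInjection (proj₁ ∘ witness) witness-injective (proj₁ ∘ proj₂ ∘ witness)
    where
    witness-injective : Injective _≡_ _≡_ (proj₁ ∘ witness)
    witness-injective {a} {b} eq =
      trans (sym (proj₂ (proj₂ (witness a)))) (trans (cong col eq) (proj₂ (proj₂ (witness b))))

  unused : ∀ {a} → ¬ Used a → ∀ {j} → P j → col j ≢ a
  unused ¬used {j} Pj eq = ¬used (j , Pj , eq)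

greedyColouring-< : ∀ {n c} (R : Fin n → Fin n → Set) → (∀ i j → Dec (R i j)) →
                    (∀ i → FewerThan c (λ j → i <ᶠ j × R i j)) →
                    ∃ λ (col : Fin n → Fin c) → ∀ {i j} → i <ᶠ j → R i j → col i ≢ col j
greedyColouring-< {zero}  R R? few = (λ ()) , λ { {()} }
greedyColouring-< {suc n} R R? few = col , proper
  where
  rest = greedyColouring-< (λ i j → R (suc i) (suc j)) (λ i j → R? (suc i) (suc j))
           (λ i → fewerThan-reindex suc suc-injective (Product.map₁ s<s) (few (suc i)))
  first = freeColour (R? zero ∘ suc)
            (fewerThan-reindex suc suc-injective (z<s ,_) (few zero)) (proj₁ rest)

  col : Fin (suc n) → Fin _
  col zero    = proj₁ first
  col (suc i) = proj₁ rest i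

  proper : ∀ {i j} → i <ᶠ j → R i j → col i ≢ col j
  proper {zero}  {suc j} _   R0j = proj₂ first R0j ∘ sym
  proper {suc i} {suc j} i<j Rij = proj₂ rest (s<s⁻¹ i<j) Rij

greedyColouring : ∀ {n c} (π : Permutation′ n) (S : Fin n → Subset n) →
                  (∀ x → x ∈ S x) → (∀ x → ∣ S x ∣ ≤ c) →
                  ∃ λ (col : Fin n → Fin c) →
                    ∀ {x y} → π ⟨$⟩ʳ x <ᶠ π ⟨$⟩ʳ y → y ∈ S x → col x ≢ col y
greedyColouring {c = c} π S x∈Sx ∣Sx∣≤c = col , proper
  where
  R : Fin _ → Fin _ → Set
  R i j = π ⟨$⟩ˡ j ∈ S (π ⟨$⟩ˡ i)

  few : ∀ i → FewerThan c (λ j → i <ᶠ j × R i j)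
  few i = fewerThan-reindex (π ⟨$⟩ˡ_) (⟨$⟩ˡ-injective π)
    (λ (i<j , Rij) → x∈p∧x≢y⇒x∈p-y Rij (λ eq → <ᶠ-irrefl (sym (⟨$⟩ˡ-injective π eq)) i<j))
    (∣p∣<⇒fewerThan (S x - x) (<-≤-trans (x∈p⇒∣p-x∣<∣p∣ (x∈Sx x)) (∣Sx∣≤c x)))
    where x = π ⟨$⟩ˡ i

  byPosition = greedyColouring-< R (λ i j → π ⟨$⟩ˡ j ∈? S (π ⟨$⟩ˡ i)) few

  col : Fin _ → Fin c
  col = proj₁ byPosition ∘ (π ⟨$⟩ʳ_)

  proper : ∀ {x y} → π ⟨$⟩ʳ x <ᶠ π ⟨$⟩ʳ y → y ∈ S x → col x ≢ col y
  proper πx<πy y∈Sx =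
    proj₂ byPosition πx<πy (subst₂ (λ a b → a ∈ S b) (sym (inverseˡ π)) (sym (inverseˡ π)) y∈Sx)

module _ {G : Graph} {p : ℕ} (D : PathDecomposition G p) where
  open PathDecomposition D

  private
    lastBag′ : ∀ v → ∃ λ i → v ∈ bag i × (∀ {j} → v ∈ bag j → j ≤ᶠ i)
    lastBag′ v = lastSatisfying (λ i → v ∈? bag i) (vCover v)

  lastBag : Fin (n G) → Fin r
  lastBag v = proj₁ (lastBag′ v)

  ∈-lastBag : ∀ v → v ∈ bag (lastBag v)
  ∈-lastBag v = proj₁ (proj₂ (lastBag′ v))

  ≤-lastBag : ∀ {v i} → v ∈ bag i → i ≤ᶠ lastBag v
  ≤-lastBag {v} = proj₂ (proj₂ (lastBag′ v))

  ∈-bag-between : ∀ {i j k v} → i ≤ᶠ j → j ≤ᶠ k → v ∈ bag i → v ∈ bag k → v ∈ bag j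
  ∈-bag-between {i} {j} {k} i≤j j≤k v∈i v∈k with i ≟ j | j ≟ k
  ... | yes refl | _        = v∈i
  ... | no _     | yes refl = v∈k
  ... | no i≢j   | no j≢k   = contig i j k _ (≤∧≢⇒< i≤j i≢j) (≤∧≢⇒< j≤k j≢k) v∈i v∈k

  bagOfEdge : ∀ {e u v} → EdgeIs G e u v → ∃ λ j → u ∈ bag j × v ∈ bag j
  bagOfEdge {e} E with ends G e | eCover e | E
  ... | _ | j , u∈j , v∈j | inj₁ refl = j , u∈j , v∈j
  ... | _ | j , v∈j , u∈j | inj₂ refl = j , u∈j , v∈j

  vertexOrder : Permutation′ (n G)
  vertexOrder = sortBy lastBag

  _≺_ : Fin (n G) → Fin (n G) → Set
  u ≺ v = vertexOrder ⟨$⟩ʳ u <ᶠ vertexOrder ⟨$⟩ʳ v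

  lastBag-mono : ∀ {u v} → u ≺ v → lastBag u ≤ᶠ lastBag v
  lastBag-mono = sortBy-sorted lastBag

  nested⇒∈lastBag : ∀ {e′ u′ v′ v} → EdgeIs G e′ u′ v′ → u′ ≺ v → v ≺ v′ → v′ ∈ bag (lastBag v)
  nested⇒∈lastBag E′ u′≺v v≺v′ =
    let (j , u′∈j , v′∈j) = bagOfEdge E′ in
    ∈-bag-between (≤-trans (≤-lastBag u′∈j) (lastBag-mono u′≺v)) (lastBag-mono v≺v′) v′∈j (∈-lastBag _)

  private
    colouring : ∃ λ (col : Fin (n G) → Fin (suc p)) →
                  ∀ {x y} → x ≺ y → y ∈ bag (lastBag x) → col x ≢ col y
    colouring = greedyColouring vertexOrder (bag ∘ lastBag) ∈-lastBag (bagSize ∘ lastBag)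

  colour : Fin (n G) → Fin (suc p)
  colour = proj₁ colouring

  colour-proper : ∀ {x y} → x ≺ y → y ∈ bag (lastBag x) → colour x ≢ colour y
  colour-proper = proj₂ colouring

  rightEnd : Fin (n G) × Fin (n G) → Fin (n G)
  rightEnd (a , b) with vertexOrder ⟨$⟩ʳ a <ᶠ? vertexOrder ⟨$⟩ʳ b
  ... | yes _ = b
  ... | no  _ = a

  rightEnd-edge : ∀ {e u v} → EdgeIs G e u v → u ≺ v → rightEnd (ends G e) ≡ v
  rightEnd-edge (inj₁ e≡uv) u≺v = trans (cong rightEnd e≡uv) (forward u≺v)
    where
    forward : ∀ {u v} → u ≺ v → rightEnd (u , v) ≡ v
    forward {u} {v} u≺v with vertexOrder ⟨$⟩ʳ u <ᶠ? vertexOrder ⟨$⟩ʳ v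
    ... | yes _   = refl
    ... | no u⊀v = contradiction u≺v u⊀v
  rightEnd-edge (inj₂ e≡vu) u≺v = trans (cong rightEnd e≡vu) (backward u≺v)
    where
    backward : ∀ {u v} → u ≺ v → rightEnd (v , u) ≡ v
    backward {u} {v} u≺v with vertexOrder ⟨$⟩ʳ v <ᶠ? vertexOrder ⟨$⟩ʳ u
    ... | yes v≺u = contradiction v≺u (<ᶠ-asym u≺v)
    ... | no _    = refl

  queue : Fin (m G) → Fin (suc p)
  queue e = colour (rightEnd (ends G e))

  queue-noNesting : ∀ {e e′ u v u′ v′} → EdgeIs G e u v → EdgeIs G e′ u′ v′ → queue e ≡ queue e′ →
                    u ≺ v → u′ ≺ v → ¬ v ≺ v′
  queue-noNesting {e} {e′} {_} {v} {_} {v′} E E′ same u≺v u′≺v v≺v′ =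
    colour-proper v≺v′ (nested⇒∈lastBag E′ u′≺v v≺v′) (begin
      colour v    ≡⟨ cong colour (rightEnd-edge E u≺v) ⟨
      queue e     ≡⟨ same ⟩
      queue e′    ≡⟨ cong colour (rightEnd-edge E′ (<ᶠ-trans u′≺v v≺v′)) ⟩
      colour v′   ∎)
    where open ≡-Reasoning

theorem5p1 : (G : Graph) (p : ℕ) → PathwidthAtMost G p → PqnAtMost G (suc p)
theorem5p1 G p D O w = record
  { pos   = vertexOrder D
  ; queue = queue D
  ; valid = λ _ _ _ _ _ _ E E′ same (_ , u≺v , u′≺v , v≺v′) →
              queue-noNesting D E E′ same u≺v u′≺v v≺v′
  }
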